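{- The proof systems QNS, Q-SA and Q-SoS are complete: every false QBF has a QNS refutation, a Q-SA refutation and a Q-SoS refutation.
   Context: A QBF $\mathcal Q.\phi$ consists of a quantifier prefix $\mathcal Q$ that quantifies each variable of a finite set $V$ of Boolean variables exactly once, existentially or universally, in a linear order, and a CNF $\phi$ over $V$; it is false if the universal player wins the evaluation game (variables assigned in prefix order, the existential player wins iff $\phi$ is satisfied). For each $v\in V$ let $\overline v$ be a new formal variable; polynomials live in $\mathbb Q[V\cup\overline V]$. A clause $C=\bigvee_{v\in P}v\vee\bigvee_{v\in N}\neg v$ is encoded as $\mathrm{enc}(C)=\{\prod_{v\in P}\overline v\prod_{v\in N}v\}\cup\{v^2-v,\ v+\overline v-1: v\in P\cup N\}$, and $\mathrm{enc}(\phi)=\bigcup_{C\in\phi}\mathrm{enc}(C)$. A Q-SoS refutation of $\mathcal Q.\phi$ is a polynomial identity $\sum_{p\in \mathrm{enc}(\phi)}q_pp+\sum_{u}q_u(1-2u)+q+1=0$, where $u$ ranges over universal variables, every variable $v$ or $\overline v$ occurring in $q_u$ has $v$ quantified to the left of $u$, and $q$ is a sum of squares; a Q-SA refutation has instead $q$ with nonnegative coefficients; a QNS refutation has $q=0$. -}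

module Defs where

open import Data.Bool using (Bool; true; false; _∧_; _∨_; not; if_then_else_)
open import Data.Nat using (ℕ; zero; suc)
open import Data.Fin using (Fin; toℕ) renaming (zero to fzero; suc to fsuc)
open import Data.Vec using (Vec; []; _∷_; lookup)
open import Data.List using (List; []; _∷_; _++_; length; foldr; allFin; concatMap)
open import Data.Bool.ListAction using (any; all)
open import Data.List.Relation.Unary.All using (All)
open import Data.Product using (proj₁; proj₂)
import Data.List as L
open import Data.Product using (Σ; _×_; _,_)
open import Data.Unit using (⊤)
open import Data.Rational using (ℚ; 0ℚ; 1ℚ; -_) renaming (_+_ to _+ℚ_; _*_ to _*ℚ_; _≤_ to _≤ℚ_)
open import Relation.Binary.PropositionalEquality using (_≡_)
import Data.Nat as N

-- QBFs.  Variables are Fin n; the quantifier prefix quantifies them in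
-- the order 0,1,…,n-1 (variable i is to the left of j iff i < j).

data Quant : Set where
  ∃q ∀q : Quant

Prefix : ℕ → Set
Prefix n = Vec Quant n

-- A clause ⋁_{v∈P} v ∨ ⋁_{v∈N} ¬v, given by the subsets P and N of V.
record Clause (n : ℕ) : Set where
  constructor clause
  field
    P : Vec Bool n
    N : Vec Bool n
open Clause public

CNF : ℕ → Set
CNF n = List (Clause n)

Assignment : ℕ → Set
Assignment n = Vec Bool n

satClause : ∀ {n} → Clause n → Assignment n → Bool
satClause {n} C ρ =
  any (λ v → (lookup (P C) v ∧ lookup ρ v) ∨ (lookup (N C) v ∧ not (lookup ρ v))) (allFin n)

satCNF : ∀ {n} → CNF n → Assignment n → Bool
satCNF φ ρ = all (λ C → satClause C ρ) φ

-- Positions of the evaluation game: the remaining prefix, and the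
-- outcome as a function of the values of the remaining variables.
data UniversalWins : ∀ {n} → Prefix n → (Assignment n → Bool) → Set where
  done   : ∀ {f} → f [] ≡ false → UniversalWins [] f
  ∃move  : ∀ {n} {qs : Prefix n} {f} →
           UniversalWins qs (λ ρ → f (true ∷ ρ)) →
           UniversalWins qs (λ ρ → f (false ∷ ρ)) →
           UniversalWins (∃q ∷ qs) f
  ∀move  : ∀ {n} {qs : Prefix n} {f} (b : Bool) →
           UniversalWins qs (λ ρ → f (b ∷ ρ)) →
           UniversalWins (∀q ∷ qs) f

FalseQBF : ∀ {n} → Prefix n → CNF n → Set
FalseQBF Q φ = UniversalWins Q (satCNF φ)

-- Polynomials in ℚ[V ∪ V̄]: ring terms modulo the commutative-ring
-- axioms together with the rational-constant relations.

data PVar (n : ℕ) : Set where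
  pos : Fin n → PVar n
  bar : Fin n → PVar n

data Poly (n : ℕ) : Set where
  var  : PVar n → Poly n
  con  : ℚ → Poly n
  _⊕_  : Poly n → Poly n → Poly n
  _⊗_  : Poly n → Poly n → Poly n

infixl 6 _⊕_
infixl 7 _⊗_
infix 4 _≈_
infixl 6 _⊖_
infix 8 ⊝_

⊝_ : ∀ {n} → Poly n → Poly n
⊝ p = con (- 1ℚ) ⊗ p

_⊖_ : ∀ {n} → Poly n → Poly n → Poly n
p ⊖ q = p ⊕ ⊝ q

data _≈_ {n : ℕ} : Poly n → Poly n → Set where
  ≈refl  : ∀ {p} → p ≈ p
  ≈sym   : ∀ {p q} → p ≈ q → q ≈ p
  ≈trans : ∀ {p q r} → p ≈ q → q ≈ r → p ≈ r
  ⊕cong  : ∀ {p p' q q'} → p ≈ p' → q ≈ q' → p ⊕ q ≈ p' ⊕ q'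
  ⊗cong  : ∀ {p p' q q'} → p ≈ p' → q ≈ q' → p ⊗ q ≈ p' ⊗ q'
  ⊕assoc : ∀ p q r → (p ⊕ q) ⊕ r ≈ p ⊕ (q ⊕ r)
  ⊕comm  : ∀ p q → p ⊕ q ≈ q ⊕ p
  ⊕idˡ   : ∀ p → con 0ℚ ⊕ p ≈ p
  ⊕invˡ  : ∀ p → (⊝ p) ⊕ p ≈ con 0ℚ
  ⊗assoc : ∀ p q r → (p ⊗ q) ⊗ r ≈ p ⊗ (q ⊗ r)
  ⊗comm  : ∀ p q → p ⊗ q ≈ q ⊗ p
  ⊗idˡ   : ∀ p → con 1ℚ ⊗ p ≈ p
  distribˡ : ∀ p q r → p ⊗ (q ⊕ r) ≈ (p ⊗ q) ⊕ (p ⊗ r)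
  con+   : ∀ a b → con a ⊕ con b ≈ con (a +ℚ b)
  con*   : ∀ a b → con a ⊗ con b ≈ con (a *ℚ b)

Uses : ∀ {n} → (Fin n → Set) → Poly n → Set
Uses S (var (pos v)) = S v
Uses S (var (bar v)) = S v
Uses S (con _)       = ⊤
Uses S (p ⊕ q)       = Uses S p × Uses S q
Uses S (p ⊗ q)       = Uses S p × Uses S q

sumFin : ∀ {n} k → (Fin k → Poly n) → Poly n
sumFin zero    f = con 0ℚ
sumFin (suc k) f = f fzero ⊕ sumFin k (λ i → f (fsuc i))

sumList : ∀ {n} → List (Poly n) → Poly n
sumList = foldr _⊕_ (con 0ℚ)

prodList : ∀ {n} → List (Poly n) → Poly n
prodList = foldr _⊗_ (con 1ℚ)

members : ∀ {n} → Vec Bool n → List (Fin n)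
members {n} S = L.filterᵇ (lookup S) (allFin n)

encClause : ∀ {n} → Clause n → List (Poly n)
encClause {n} C =
  prodList (L.map (λ v → var (bar v)) (members (P C)) ++ L.map (λ v → var (pos v)) (members (N C)))
  ∷ concatMap (λ v → if lookup (P C) v ∨ lookup (N C) v
                     then (var (pos v) ⊗ var (pos v) ⊖ var (pos v))
                          ∷ (var (pos v) ⊕ var (bar v) ⊖ con 1ℚ) ∷ []
                     else [])
              (allFin n)

enc : ∀ {n} → CNF n → List (Poly n)
enc φ = concatMap encClause φ

IsUniversal : Quant → Bool
IsUniversal ∃q = false
IsUniversal ∀q = true

Refutation : ∀ {n} → (Poly n → Set) → Prefix n → CNF n → Set
Refutation {n} Allowed Q φ =
  Σ (Fin (length (enc φ)) → Poly n) λ qp →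
  Σ (Fin n → Poly n) λ qu →
  ((u : Fin n) → lookup Q u ≡ ∀q → Uses (λ v → toℕ v N.< toℕ u) (qu u)) ×
  Σ (Poly n) λ q → Allowed q ×
  (sumFin (length (enc φ)) (λ i → qp i ⊗ L.lookup (enc φ) i)
     ⊕ sumFin n (λ u → if IsUniversal (lookup Q u)
                        then qu u ⊗ (con 1ℚ ⊖ con (1ℚ +ℚ 1ℚ) ⊗ var (pos u))
                        else con 0ℚ)
     ⊕ q ⊕ con 1ℚ
   ≈ con 0ℚ)

IsZeroPoly : ∀ {n} → Poly n → Set
IsZeroPoly q = q ≈ con 0ℚ

IsSoS : ∀ {n} → Poly n → Set
IsSoS {n} q = Σ (List (Poly n)) λ ss → q ≈ sumList (L.map (λ s → s ⊗ s) ss)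

NonnegCoeffs : ∀ {n} → Poly n → Set
NonnegCoeffs {n} q =
  Σ (List (ℚ × List (PVar n))) λ terms →
  All (λ t → 0ℚ ≤ℚ proj₁ t) terms ×
  (q ≈ sumList (L.map (λ t → con (proj₁ t) ⊗ prodList (L.map var (proj₂ t))) terms))

QNSRefutation QSARefutation QSoSRefutation : ∀ {n} → Prefix n → CNF n → Set
QNSRefutation  = Refutation IsZeroPoly
QSARefutation  = Refutation NonnegCoeffs
QSoSRefutation = Refutation IsSoS

-- Let J be the set of polynomials Σ q_p p + Σ q_u (1 − 2u) with q_u only involving
-- variables to the left of u. J is closed under sums and negation, and −1 ∈ J gives a
-- refutation with q = 0, which is at once a QNS, a Q-SA and a Q-SoS refutation.
-- We show M ∈ J by recursion along a winning strategy of the universal player, where M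
-- is the product of the literals set so far. At an existential variable x,
-- M = M x + M (1 − x); at a universal variable x set to b with literal ℓ,
-- M = 2 M ℓ ± M (1 − 2x), and M only involves variables left of x. At the end of a play
-- some clause C is falsified; replacing each literal 1 − v of a positive v ∈ C by v̄
-- modulo v + v̄ − 1 turns the product of all literals into a multiple of the monomial
-- of enc(C).
module Submission where

open import Defs
open import Data.Nat using (ℕ; zero; suc; _+_; _<_)
import Data.Nat.Properties as ℕₚ
open import Data.Product using (_×_; Σ; _,_)
open import Data.Bool using (Bool; true; false; T; _∧_; _∨_; not; if_then_else_)
open import Data.Fin using (Fin; toℕ) renaming (zero to fzero; suc to fsuc)
open import Data.Vec using ([]; _∷_; lookup)
open import Data.List as L using (List; []; _∷_; _++_; length; allFin)
open import Data.List.Properties using (map-tabulate)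
open import Data.List.Relation.Unary.Any using (here; there; index)
open import Data.List.Relation.Unary.Any.Properties using (lookup-index; any⁺)
open import Data.List.Relation.Unary.All using ([])
open import Data.List.Relation.Unary.All.Properties using (all⁻; ¬All⇒Any¬)
open import Data.List.Relation.Binary.Subset.Propositional using (_⊆_)
open import Data.List.Membership.Propositional using (_∈_; lose; find)
open import Data.List.Membership.Propositional.Properties using (∈-concatMap⁺; ∈-allFin)
open import Data.Unit using (tt)
open import Data.Empty using (⊥-elim)
open import Data.Maybe using (Maybe; just; nothing)
open import Data.Rational using (0ℚ; 1ℚ; -_) renaming (_+_ to _+ℚ_; _*_ to _*ℚ_)
open import Data.Rational.Properties using (_≟_; +-*-commutativeRing)
open import Function using (id; _∘_)
open import Relation.Binary.PropositionalEquality using (_≡_; refl; sym; trans; cong; cong₂; subst)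
open import Relation.Binary.Bundles using (Setoid)
open import Relation.Nullary using (¬_; yes; no)
open import Relation.Nullary.Decidable using (T?)
open import Algebra.Bundles using (CommutativeRing)
open import Algebra.Structures using (IsCommutativeRing)
open import Algebra.Solver.Ring.AlmostCommutativeRing
  using (fromCommutativeRing; _-Raw-AlmostCommutative⟶_)
import Algebra.Consequences.Setoid as Consequences
open import Algebra.Properties.Ring (CommutativeRing.ring +-*-commutativeRing) using (-1*x≈-x)

module PolynomialRing (n : ℕ) where

  ≈-setoid : Setoid _ _
  ≈-setoid = record
    { Carrier = Poly n ; _≈_ = _≈_
    ; isEquivalence = record { refl = ≈refl ; sym = ≈sym ; trans = ≈trans } }

  open Consequences ≈-setoid using (comm∧idˡ⇒id; comm∧invˡ⇒inv; comm∧distrˡ⇒distr)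

  isCommutativeRing : IsCommutativeRing _≈_ _⊕_ _⊗_ ⊝_ (con 0ℚ) (con 1ℚ)
  isCommutativeRing = record
    { isRing = record
      { +-isAbelianGroup = record
        { isGroup = record
          { isMonoid = record
            { isSemigroup = record
              { isMagma = record { isEquivalence = Setoid.isEquivalence ≈-setoid ; ∙-cong = ⊕cong }
              ; assoc = ⊕assoc }
            ; identity = comm∧idˡ⇒id ⊕comm ⊕idˡ }
          ; inverse = comm∧invˡ⇒inv ⊕comm ⊕invˡ
          ; ⁻¹-cong = ⊗cong ≈refl }
        ; comm = ⊕comm }
      ; *-cong = ⊗cong
      ; *-assoc = ⊗assoc
      ; *-identity = comm∧idˡ⇒id ⊗comm ⊗idˡ
      ; distrib = comm∧distrˡ⇒distr ⊕cong ⊗comm distribˡ }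
    ; *-comm = ⊗comm }

  commutativeRing : CommutativeRing _ _
  commutativeRing = record { isCommutativeRing = isCommutativeRing }

  open CommutativeRing commutativeRing public using (+-identityʳ; *-identityʳ; distribʳ; zeroˡ)
  open Setoid ≈-setoid public using () renaming (reflexive to ≈-reflexive)

  constants : CommutativeRing.rawRing +-*-commutativeRing
                -Raw-AlmostCommutative⟶ fromCommutativeRing commutativeRing
  constants = record
    { ⟦_⟧ = con
    ; +-homo = λ a b → ≈sym (con+ a b)
    ; *-homo = λ a b → ≈sym (con* a b)
    ; -‿homo = λ a → ≈trans (≈-reflexive (cong con (sym (-1*x≈-x a)))) (≈sym (con* (- 1ℚ) a))
    ; 0-homo = ≈refl
    ; 1-homo = ≈refl }

  con-≟ : ∀ a b → Maybe (con {n} a ≈ con b)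
  con-≟ a b with a ≟ b
  ... | yes refl = just ≈refl
  ... | no _     = nothing

  open import Algebra.Solver.Ring (CommutativeRing.rawRing +-*-commutativeRing)
    (fromCommutativeRing commutativeRing) constants con-≟ public

Uses-mono : ∀ {n} {S T : Fin n → Set} → (∀ v → S v → T v) → ∀ p → Uses S p → Uses T p
Uses-mono S⊆T (var (pos v)) s = S⊆T v s
Uses-mono S⊆T (var (bar v)) s = S⊆T v s
Uses-mono S⊆T (con _)       s = tt
Uses-mono S⊆T (p ⊕ q) (s , t) = Uses-mono S⊆T p s , Uses-mono S⊆T q t
Uses-mono S⊆T (p ⊗ q) (s , t) = Uses-mono S⊆T p s , Uses-mono S⊆T q t

data Ideal {n : ℕ} (G : List (Poly n)) : Poly n → Set where
  gen  : ∀ {g} → g ∈ G → (c : Poly n) → Ideal G (c ⊗ g)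
  plus : ∀ {p q} → Ideal G p → Ideal G q → Ideal G (p ⊕ q)
  resp : ∀ {p q} → p ≈ q → Ideal G p → Ideal G q

filterᵇ-∷ : ∀ {A : Set} (p : A → Bool) x xs →
            L.filterᵇ p (x ∷ xs) ≡ (if p x then x ∷ L.filterᵇ p xs else L.filterᵇ p xs)
filterᵇ-∷ p x xs with p x
... | true  = refl
... | false = refl

module _ {n : ℕ} where
  open PolynomialRing n

  Ideal-*ˡ : ∀ {G : List (Poly n)} d {p} → Ideal G p → Ideal G (d ⊗ p)
  Ideal-*ˡ d (gen g∈G c) = resp (⊗assoc d c _) (gen g∈G (d ⊗ c))
  Ideal-*ˡ d (plus x y)  = resp (≈sym (distribˡ d _ _)) (plus (Ideal-*ˡ d x) (Ideal-*ˡ d y))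
  Ideal-*ˡ d (resp e x)  = resp (⊗cong ≈refl e) (Ideal-*ˡ d x)

  Ideal-mono : ∀ {G H : List (Poly n)} → G ⊆ H → ∀ {p} → Ideal G p → Ideal H p
  Ideal-mono G⊆H (gen g∈G c) = gen (G⊆H g∈G) c
  Ideal-mono G⊆H (plus x y)  = plus (Ideal-mono G⊆H x) (Ideal-mono G⊆H y)
  Ideal-mono G⊆H (resp e x)  = resp e (Ideal-mono G⊆H x)

  sumFin-cong : ∀ k {f g : Fin k → Poly n} → (∀ i → f i ≈ g i) → sumFin k f ≈ sumFin k g
  sumFin-cong zero    f≈g = ≈refl
  sumFin-cong (suc k) f≈g = ⊕cong (f≈g fzero) (sumFin-cong k (f≈g ∘ fsuc))

  sumFin-zero : ∀ k {f : Fin k → Poly n} → (∀ i → f i ≈ con 0ℚ) → sumFin k f ≈ con 0ℚ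
  sumFin-zero zero    f≈0 = ≈refl
  sumFin-zero (suc k) f≈0 = ≈trans (⊕cong (f≈0 fzero) (sumFin-zero k (f≈0 ∘ fsuc))) (⊕idˡ _)

  sumFin-⊕ : ∀ k (f g : Fin k → Poly n) → sumFin k (λ i → f i ⊕ g i) ≈ sumFin k f ⊕ sumFin k g
  sumFin-⊕ zero    f g = ≈sym (⊕idˡ _)
  sumFin-⊕ (suc k) f g = ≈trans (⊕cong ≈refl (sumFin-⊕ k (f ∘ fsuc) (g ∘ fsuc)))
    (solve 4 (λ a b c d → (a :+ b) :+ (c :+ d) := (a :+ c) :+ (b :+ d)) ≈refl (f fzero) (g fzero) _ _)

  sumFin-⊝ : ∀ k (f : Fin k → Poly n) → sumFin k (λ i → ⊝ f i) ≈ ⊝ sumFin k f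
  sumFin-⊝ zero    f = solve 0 (con 0ℚ := :- con 0ℚ) ≈refl
  sumFin-⊝ (suc k) f = ≈trans (⊕cong ≈refl (sumFin-⊝ k (f ∘ fsuc)))
    (solve 2 (λ a b → (:- a) :+ (:- b) := :- (a :+ b)) ≈refl (f fzero) _)

  single : ∀ {k} → Fin k → Poly n → Fin k → Poly n
  single fzero    c fzero    = c
  single fzero    c (fsuc _) = con 0ℚ
  single (fsuc _) c fzero    = con 0ℚ
  single (fsuc j) c (fsuc i) = single j c i

  single-elim : ∀ {k} (S : Fin k → Poly n → Set) {j c} → S j c → (∀ i → S i (con 0ℚ)) →
                ∀ i → S i (single j c i)
  single-elim S {fzero}  Sjc S0 fzero    = Sjc
  single-elim S {fzero}  Sjc S0 (fsuc i) = S0 (fsuc i)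
  single-elim S {fsuc j} Sjc S0 fzero    = S0 fzero
  single-elim S {fsuc j} Sjc S0 (fsuc i) = single-elim (S ∘ fsuc) Sjc (S0 ∘ fsuc) i

  sumFin-single : ∀ k (F : Fin k → Poly n → Poly n) → (∀ i → F i (con 0ℚ) ≈ con 0ℚ) →
                  ∀ j c → sumFin k (λ i → F i (single j c i)) ≈ F j c
  sumFin-single (suc k) F F0 fzero c =
    ≈trans (⊕cong ≈refl (sumFin-zero k (F0 ∘ fsuc))) (+-identityʳ _)
  sumFin-single (suc k) F F0 (fsuc j) c =
    ≈trans (⊕cong (F0 fzero) (sumFin-single k (F ∘ fsuc) (F0 ∘ fsuc) j c)) (⊕idˡ _)

  prodList-++ : ∀ (xs ys : List (Poly n)) → prodList (xs ++ ys) ≈ prodList xs ⊗ prodList ys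
  prodList-++ []       ys = ≈sym (⊗idˡ _)
  prodList-++ (x ∷ xs) ys = ≈trans (⊗cong ≈refl (prodList-++ xs ys)) (≈sym (⊗assoc _ _ _))

  literal : Bool → Fin n → Poly n
  literal true  x = var (pos x)
  literal false x = con 1ℚ ⊖ var (pos x)

  Uses-literal : ∀ {S : Fin n → Set} b {x} → S x → Uses S (literal b x)
  Uses-literal true  s = s
  Uses-literal false s = tt , tt , s

  literalProduct : ∀ {m} → (Fin m → Fin n) → Assignment m → Poly n
  literalProduct position ρ = prodList (L.tabulate (λ i → literal (lookup ρ i) (position i)))

  spin : Fin n → Poly n
  spin u = con 1ℚ ⊖ con (1ℚ +ℚ 1ℚ) ⊗ var (pos u)

  existential-split : ∀ M x → M ≈ M ⊗ literal true x ⊕ M ⊗ literal false x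
  existential-split M x = solve 2 (λ a v → a := a :* v :+ a :* (con 1ℚ :- v)) ≈refl M (var (pos x))

  universal-split-true : ∀ M x → M ≈ (M ⊗ literal true x ⊕ M ⊗ literal true x) ⊕ M ⊗ spin x
  universal-split-true M x =
    solve 2 (λ a v → a := (a :* v :+ a :* v) :+ a :* (con 1ℚ :- con (1ℚ +ℚ 1ℚ) :* v))
      ≈refl M (var (pos x))

  universal-split-false : ∀ M x → M ≈ (M ⊗ literal false x ⊕ M ⊗ literal false x) ⊕ ⊝ (M ⊗ spin x)
  universal-split-false M x =
    solve 2 (λ a v → a := (a :* (con 1ℚ :- v) :+ a :* (con 1ℚ :- v))
                          :+ :- (a :* (con 1ℚ :- con (1ℚ +ℚ 1ℚ) :* v)))
      ≈refl M (var (pos x))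

module Representation {n : ℕ} (Q : Prefix n) (E : List (Poly n)) where
  open PolynomialRing n

  universalTerm : Fin n → Poly n → Poly n
  universalTerm u c = if IsUniversal (lookup Q u) then c ⊗ spin u else con 0ℚ

  Representable : Poly n → Set
  Representable p =
    Σ (Fin (length E) → Poly n) λ qp →
    Σ (Fin n → Poly n) λ qu →
    ((u : Fin n) → lookup Q u ≡ ∀q → Uses (λ v → toℕ v < toℕ u) (qu u)) ×
    (p ≈ sumFin (length E) (λ i → qp i ⊗ L.lookup E i) ⊕ sumFin n (λ u → universalTerm u (qu u)))

  universalTerm-zero : ∀ u → universalTerm u (con 0ℚ) ≈ con 0ℚ
  universalTerm-zero u with lookup Q u
  ... | ∃q = ≈refl
  ... | ∀q = zeroˡ _

  universalTerm-⊕ : ∀ u a b → universalTerm u (a ⊕ b) ≈ universalTerm u a ⊕ universalTerm u b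
  universalTerm-⊕ u a b with lookup Q u
  ... | ∃q = ≈sym (⊕idˡ _)
  ... | ∀q = distribʳ _ a b

  universalTerm-⊝ : ∀ u a → universalTerm u (⊝ a) ≈ ⊝ universalTerm u a
  universalTerm-⊝ u a with lookup Q u
  ... | ∃q = solve 0 (con 0ℚ := :- con 0ℚ) ≈refl
  ... | ∀q = ⊗assoc _ _ _

  universalTerm-universal : ∀ {u c} → lookup Q u ≡ ∀q → universalTerm u c ≈ c ⊗ spin u
  universalTerm-universal u∀ rewrite u∀ = ≈refl

  representable-resp : ∀ {p q} → p ≈ q → Representable p → Representable q
  representable-resp p≈q (qp , qu , qu-uses , p≈) = qp , qu , qu-uses , ≈trans (≈sym p≈q) p≈

  representable-⊕ : ∀ {p q} → Representable p → Representable q → Representable (p ⊕ q)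
  representable-⊕ (qp , qu , qu-uses , p≈) (qp′ , qu′ , qu′-uses , q≈) =
    (λ i → qp i ⊕ qp′ i) , (λ u → qu u ⊕ qu′ u) , (λ u u∀ → qu-uses u u∀ , qu′-uses u u∀) ,
    ≈trans (⊕cong p≈ q≈) (≈sym (≈trans
      (⊕cong (≈trans (sumFin-cong _ (λ i → distribʳ _ (qp i) (qp′ i))) (sumFin-⊕ _ _ _))
             (≈trans (sumFin-cong n (λ u → universalTerm-⊕ u (qu u) (qu′ u))) (sumFin-⊕ n _ _)))
      (solve 4 (λ a b c d → (a :+ b) :+ (c :+ d) := (a :+ c) :+ (b :+ d)) ≈refl _ _ _ _)))

  representable-⊝ : ∀ {p} → Representable p → Representable (⊝ p)
  representable-⊝ (qp , qu , qu-uses , p≈) =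
    (λ i → ⊝ qp i) , (λ u → ⊝ qu u) , (λ u u∀ → tt , qu-uses u u∀) ,
    ≈trans (⊗cong ≈refl p≈) (≈sym (≈trans
      (⊕cong (≈trans (sumFin-cong _ (λ i → ⊗assoc _ (qp i) _)) (sumFin-⊝ _ _))
             (≈trans (sumFin-cong n (λ u → universalTerm-⊝ u (qu u))) (sumFin-⊝ n _)))
      (solve 2 (λ a b → (:- a) :+ (:- b) := :- (a :+ b)) ≈refl _ _)))

  representable-generator : ∀ i c → Representable (c ⊗ L.lookup E i)
  representable-generator i c =
    single i c , (λ _ → con 0ℚ) , (λ _ _ → tt) ,
    ≈sym (≈trans (⊕cong (sumFin-single _ (λ j a → a ⊗ L.lookup E j) (λ j → zeroˡ _) i c)
                        (sumFin-zero n universalTerm-zero))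
                 (+-identityʳ _))

  representable-ideal : ∀ {p} → Ideal E p → Representable p
  representable-ideal (gen g∈E c) =
    representable-resp (⊗cong ≈refl (≈-reflexive (sym (lookup-index g∈E))))
      (representable-generator (index g∈E) c)
  representable-ideal (plus x y) = representable-⊕ (representable-ideal x) (representable-ideal y)
  representable-ideal (resp e x) = representable-resp e (representable-ideal x)

  representable-universal : ∀ {u c} → lookup Q u ≡ ∀q → Uses (λ v → toℕ v < toℕ u) c →
                            Representable (c ⊗ spin u)
  representable-universal {u} {c} u∀ c-uses =
    (λ _ → con 0ℚ) , single u c ,
    single-elim (λ v a → lookup Q v ≡ ∀q → Uses (λ w → toℕ w < toℕ v) a) {u} {c}
                (λ _ → c-uses) (λ _ _ → tt) ,
    ≈sym (≈trans (⊕cong (sumFin-zero _ (λ i → zeroˡ _))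
                        (sumFin-single n universalTerm universalTerm-zero u c))
                 (≈trans (⊕idˡ _) (universalTerm-universal u∀)))

  representable-existential : ∀ {M x} → Representable (M ⊗ literal true x) →
                              Representable (M ⊗ literal false x) → Representable M
  representable-existential {M} {x} r₁ r₀ =
    representable-resp (≈sym (existential-split M x)) (representable-⊕ r₁ r₀)

  representable-universal-step : ∀ {M x} b → lookup Q x ≡ ∀q → Uses (λ v → toℕ v < toℕ x) M →
                                 Representable (M ⊗ literal b x) → Representable M
  representable-universal-step {M} {x} true x∀ M-uses r =
    representable-resp (≈sym (universal-split-true M x))
      (representable-⊕ (representable-⊕ r r) (representable-universal x∀ M-uses))
  representable-universal-step {M} {x} false x∀ M-uses r =
    representable-resp (≈sym (universal-split-false M x))
      (representable-⊕ (representable-⊕ r r) (representable-⊝ (representable-universal x∀ M-uses)))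

  record Suffix {m} (qs : Prefix m) (d : ℕ) : Set where
    field
      position     : Fin m → Fin n
      position-toℕ : ∀ i → toℕ (position i) ≡ d + toℕ i
      quantifier   : ∀ i → lookup qs i ≡ lookup Q (position i)

  open Suffix

  Suffix-tail : ∀ {m q d} {qs : Prefix m} → Suffix (q ∷ qs) d → Suffix qs (suc d)
  Suffix-tail {d = d} s = record
    { position     = position s ∘ fsuc
    ; position-toℕ = λ i → trans (position-toℕ s (fsuc i)) (ℕₚ.+-suc d (toℕ i))
    ; quantifier   = quantifier s ∘ fsuc }

  Suffix-head-toℕ : ∀ {m q d} {qs : Prefix m} (s : Suffix (q ∷ qs) d) → toℕ (position s fzero) ≡ d
  Suffix-head-toℕ {d = d} s = trans (position-toℕ s fzero) (ℕₚ.+-identityʳ d)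

  Suffix-whole : Suffix Q 0
  Suffix-whole = record { position = id ; position-toℕ = λ _ → refl ; quantifier = λ _ → refl }

  mutual
    representable-byStrategy : ∀ {m d M} {qs : Prefix m} {f : Assignment m → Bool} →
      UniversalWins qs f → (s : Suffix qs d) → Uses (λ v → toℕ v < d) M →
      ((ρ : Assignment m) → f ρ ≡ false → Representable (M ⊗ literalProduct (position s) ρ)) →
      Representable M
    representable-byStrategy (done lost) s M-uses leaf = representable-resp (*-identityʳ _) (leaf [] lost)
    representable-byStrategy (∃move w₁ w₀) s M-uses leaf =
      representable-existential (representable-afterMove w₁ s M-uses leaf)
                                (representable-afterMove w₀ s M-uses leaf)
    representable-byStrategy {M = M} (∀move b w) s M-uses leaf =
      representable-universal-step b (sym (quantifier s fzero))
        (subst (λ k → Uses (λ v → toℕ v < k) M) (sym (Suffix-head-toℕ s)) M-uses)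
        (representable-afterMove w s M-uses leaf)

    representable-afterMove : ∀ {m d M b q} {qs : Prefix m} {f : Assignment (suc m) → Bool} →
      UniversalWins qs (λ ρ → f (b ∷ ρ)) → (s : Suffix (q ∷ qs) d) →
      Uses (λ v → toℕ v < d) M →
      ((ρ : Assignment (suc m)) → f ρ ≡ false → Representable (M ⊗ literalProduct (position s) ρ)) →
      Representable (M ⊗ literal b (position s fzero))
    representable-afterMove {d = d} {M} {b} w s M-uses leaf =
      representable-byStrategy w (Suffix-tail s)
        (Uses-mono (λ _ → ℕₚ.m<n⇒m<1+n) M M-uses ,
         Uses-literal b (subst (_< suc d) (sym (Suffix-head-toℕ s)) (ℕₚ.n<1+n d)))
        (λ ρ lost → representable-resp (≈sym (⊗assoc _ _ _)) (leaf (b ∷ ρ) lost))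

module FalsifiedClause {n : ℕ} (C : Clause n) (ρ : Assignment n) where
  open PolynomialRing n

  monomial : List (Fin n) → List (Fin n) → Poly n
  monomial B N = prodList (L.map (λ v → var (bar v)) B) ⊗ prodList (L.map (λ v → var (pos v)) N)

  clauseMonomial : List (Fin n) → Poly n
  clauseMonomial xs = monomial (L.filterᵇ (lookup (P C)) xs) (L.filterᵇ (lookup (N C)) xs)

  complementAxiom : Fin n → Poly n
  complementAxiom v = var (pos v) ⊕ var (bar v) ⊖ con 1ℚ

  clauseMonomial∈enc : prodList (L.map (λ v → var (bar v)) (members (P C))
                                 ++ L.map (λ v → var (pos v)) (members (N C))) ∈ encClause C
  clauseMonomial∈enc = here refl

  complementAxiom∈enc : ∀ v → T (lookup (P C) v) → complementAxiom v ∈ encClause C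
  complementAxiom∈enc v v∈P =
    there (∈-concatMap⁺ _ (lose (∈-allFin v) (axioms∋ (lookup (P C) v) v∈P)))
    where
    axioms∋ : ∀ {a} b {c} → T b →
              complementAxiom v ∈ (if b ∨ c then a ∷ complementAxiom v ∷ [] else [])
    axioms∋ true _ = there (here refl)

  literals : List (Fin n) → Poly n
  literals xs = prodList (L.map (λ v → literal (lookup ρ v) v) xs)

  ReducesToClauseMonomial : List (Fin n) → Set
  ReducesToClauseMonomial xs = Σ (Poly n) λ R →
    Ideal (encClause C) (literals xs ⊖ R ⊗ clauseMonomial xs)

  reduce-step : ∀ v (inP inN val : Bool) → ¬ T ((inP ∧ val) ∨ (inN ∧ not val)) →
    (T inP → complementAxiom v ∈ encClause C) →
    ∀ X R B N → Ideal (encClause C) (X ⊖ R ⊗ monomial B N) →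
    Σ (Poly n) λ R′ → Ideal (encClause C)
      (literal val v ⊗ X ⊖ R′ ⊗ monomial (if inP then v ∷ B else B) (if inN then v ∷ N else N))
  reduce-step v true  false false _ axiom∈ X R B N x = R ,
    resp (solve 6 (λ x r b m y y̅ →
                     (con 1ℚ :- y) :* (x :- r :* (b :* m)) :+ (:- (r :* (b :* m))) :* ((y :+ y̅) :- con 1ℚ)
                     := (con 1ℚ :- y) :* x :- r :* ((y̅ :* b) :* m))
            ≈refl X R _ _ (var (pos v)) (var (bar v)))
      (plus (Ideal-*ˡ (con 1ℚ ⊖ var (pos v)) x) (gen (axiom∈ tt) _))
  reduce-step v false true  true  _ _ X R B N x = R ,
    resp (solve 5 (λ x r b m y → y :* (x :- r :* (b :* m)) := y :* x :- r :* (b :* (y :* m)))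
            ≈refl X R _ _ (var (pos v)))
      (Ideal-*ˡ (var (pos v)) x)
  reduce-step v false false val   _ _ X R B N x = literal val v ⊗ R ,
    resp (solve 5 (λ x r b m ℓ → ℓ :* (x :- r :* (b :* m)) := ℓ :* x :- (ℓ :* r) :* (b :* m))
            ≈refl X R _ _ (literal val v))
      (Ideal-*ˡ (literal val v) x)
  reduce-step v true  _     true  sat _ _ _ _ _ _ = ⊥-elim (sat tt)
  reduce-step v true  true  false sat _ _ _ _ _ _ = ⊥-elim (sat tt)
  reduce-step v false true  false sat _ _ _ _ _ _ = ⊥-elim (sat tt)

  reduce : (∀ v → ¬ T ((lookup (P C) v ∧ lookup ρ v) ∨ (lookup (N C) v ∧ not (lookup ρ v)))) →
           ∀ xs → ReducesToClauseMonomial xs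
  reduce falsified [] = con 1ℚ ,
    resp (solve 1 (λ g → con 0ℚ :* g := con 1ℚ :- con 1ℚ :* (con 1ℚ :* con 1ℚ)) ≈refl _)
      (gen clauseMonomial∈enc (con 0ℚ))
  reduce falsified (v ∷ xs) =
    let R , x = reduce falsified xs
        R′ , x′ = reduce-step v (lookup (P C) v) (lookup (N C) v) (lookup ρ v) (falsified v)
                    (complementAxiom∈enc v) _ R _ _ x
    in R′ , resp (≈-reflexive (cong (λ m → literal (lookup ρ v) v ⊗ literals xs ⊖ R′ ⊗ m)
                   (sym (cong₂ monomial (filterᵇ-∷ (lookup (P C)) v xs)
                                        (filterᵇ-∷ (lookup (N C)) v xs))))) x′

  literalProduct∈ideal : ¬ T (satClause C ρ) → Ideal (encClause C) (literalProduct id ρ)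
  literalProduct∈ideal unsat =
    let R , x = reduce (λ v sat → unsat (any⁺ _ (lose (∈-allFin v) sat))) (allFin n)
    in resp (≈trans (⊕cong ≈refl (⊗cong ≈refl (prodList-++ (L.map (λ v → var (bar v)) (members (P C)))
                                                           (L.map (λ v → var (pos v)) (members (N C))))))
            (≈trans (solve 2 (λ a b → (a :- b) :+ b := a) ≈refl _ (R ⊗ clauseMonomial (allFin n)))
                    (≈-reflexive (cong prodList (map-tabulate id (λ v → literal (lookup ρ v) v))))))
         (plus x (gen clauseMonomial∈enc R))

module _ {n : ℕ} (Q : Prefix n) (φ : CNF n) where
  open PolynomialRing n
  open Representation Q (enc φ)

  encClause⊆enc : ∀ {C} → C ∈ φ → encClause C ⊆ enc φ
  encClause⊆enc C∈φ g∈C = ∈-concatMap⁺ _ (lose C∈φ g∈C)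

  representable-falsified : ∀ ρ → satCNF φ ρ ≡ false → Representable (con 1ℚ ⊗ literalProduct id ρ)
  representable-falsified ρ lost =
    let C , C∈φ , unsat =
          find (¬All⇒Any¬ (λ C → T? (satClause C ρ)) φ (λ sat → subst T lost (all⁻ _ sat)))
    in representable-resp (≈sym (⊗idˡ _))
         (representable-ideal (Ideal-mono (encClause⊆enc C∈φ)
                                          (FalsifiedClause.literalProduct∈ideal C ρ unsat)))

  representable-minusOne : FalseQBF Q φ → Representable (⊝ con 1ℚ)
  representable-minusOne lost =
    representable-⊝ (representable-byStrategy lost Suffix-whole tt representable-falsified)

  refutation : (Allowed : Poly n → Set) → Allowed (con 0ℚ) → FalseQBF Q φ → Refutation Allowed Q φ
  refutation _ allowed-zero lost =
    let qp , qu , qu-uses , minusOne≈ = representable-minusOne lost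
    in qp , qu , qu-uses , con 0ℚ , allowed-zero ,
       ≈trans (⊕cong (⊕cong (≈sym minusOne≈) ≈refl) ≈refl)
              (solve 0 ((:- con 1ℚ :+ con 0ℚ) :+ con 1ℚ := con 0ℚ) ≈refl)

corollary3p8 : (n : ℕ) (Q : Prefix n) (φ : CNF n) → FalseQBF Q φ →
    QNSRefutation Q φ × QSARefutation Q φ × QSoSRefutation Q φ
corollary3p8 n Q φ lost =
  refutation Q φ IsZeroPoly ≈refl lost ,
  refutation Q φ NonnegCoeffs ([] , [] , ≈refl) lost ,
  refutation Q φ IsSoS ([] , ≈refl) lost
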